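{- If $x$ is a lower, i.e. $\forall z\in x,\ z\notin z$, then $x\notin x$.
   Context: An object $x$ is called a lower (Lower Russellian Set) if every member of $x$ is not a member of itself. -}

module Defs where

open import Level using (Level; suc; _⊔_)
open import Relation.Nullary using (¬_)

Lower : ∀ {a ℓ} {U : Set a} → (U → U → Set ℓ) → U → Set (a ⊔ ℓ)
Lower _∈_ x = ∀ z → z ∈ x → ¬ (z ∈ z)

module Submission where

open import Defs
open import Relation.Nullary using (¬_)

lemma3p1 : ∀ {a ℓ} {U : Set a} (_∈_ : U → U → Set ℓ) (x : U) →
    Lower _∈_ x → ¬ (x ∈ x)
lemma3p1 _∈_ x lower x∈x = lower x x∈x x∈x
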